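{- There exists an infinite, uniformly recurrent, aperiodic binary word $w$ which is closed under reversal, which contains only finitely many distinct palindromic factors, and whose set of palindromic factors is a proper subset of its set of privileged factors.
   Context: An infinite word $w$ is uniformly recurrent if for each factor $u$ there is $R$ such that every factor of $w$ of length $R$ contains $u$; it is aperiodic if it is not of the form $uvvv\cdots$ with $v$ nonempty. A word is closed under reversal if the reversal of each of its factors is also a factor. A palindrome is a word equal to its reversal. A complete first return to a word $v$ is a word that begins with $v$, ends with $v$, and contains exactly two occurrences of $v$. Privileged words: the empty word and every letter are privileged, and a word is privileged if it is a complete first return to a shorter privileged word. -}

module Defs where

open import Data.Bool using (Bool)
open import Data.Bool.Properties using () renaming (_≟_ to _≟B_)
open import Data.Nat using (ℕ; _+_; _<_; _≤_)
open import Data.List using (List; []; _∷_; [_]; _++_; map; upTo; length; take; tails; filter; reverse)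
open import Data.List.Properties using (≡-dec)
open import Data.List.Membership.Propositional using (_∈_)
open import Data.Product using (Σ; ∃; ∃-syntax; _×_; _,_)
open import Relation.Nullary using (¬_)
open import Relation.Binary.PropositionalEquality using (_≡_)

Word : Set
Word = ℕ → Bool

factorAt : Word → ℕ → ℕ → List Bool
factorAt w i n = map (λ k → w (i + k)) (upTo n)

IsFactor : List Bool → Word → Set
IsFactor u w = ∃[ i ] factorAt w i (length u) ≡ u

UniformlyRecurrent : Word → Set
UniformlyRecurrent w =
  ∀ u → IsFactor u w →
  ∃[ R ] (∀ i → ∃[ j ] (j + length u ≤ R × factorAt w (i + j) (length u) ≡ u))

-- Eventually periodic: w = u v v v ... with v nonempty
-- (p = |v| > 0, N = |u|).
EventuallyPeriodic : Word → Set
EventuallyPeriodic w = ∃[ p ] ∃[ N ] (0 < p × (∀ n → N ≤ n → w (n + p) ≡ w n))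

Aperiodic : Word → Set
Aperiodic w = ¬ EventuallyPeriodic w

ClosedUnderReversal : Word → Set
ClosedUnderReversal w = ∀ u → IsFactor u w → IsFactor (reverse u) w

Palindrome : List Bool → Set
Palindrome u = reverse u ≡ u

-- Number of occurrences of v in u (as a factor, counting all positions,
-- overlapping allowed): number of suffixes of u having v as prefix.
occurrences : List Bool → List Bool → ℕ
occurrences v u = length (filter (λ s → ≡-dec _≟B_ (take (length v) s) v) (tails u))

CompleteFirstReturn : List Bool → List Bool → Set
CompleteFirstReturn v u =
  (∃[ s ] u ≡ v ++ s) × (∃[ p ] u ≡ p ++ v) × occurrences v u ≡ 2

data Privileged : List Bool → Set where
  priv-empty  : Privileged []
  priv-letter : ∀ a → Privileged [ a ]
  priv-return : ∀ {v u} → Privileged v → length v < length u →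
                CompleteFirstReturn v u → Privileged u

FinitelyManyPalindromicFactors : Word → Set
FinitelyManyPalindromicFactors w =
  ∃[ L ] (∀ u → IsFactor u w → Palindrome u → u ∈ L)

PalFactorsProperSubsetPrivFactors : Word → Set
PalFactorsProperSubsetPrivFactors w =
  (∀ u → IsFactor u w → Palindrome u → Privileged u) ×
  (∃[ u ] (IsFactor u w × Privileged u × ¬ Palindrome u))

module Submission where

open import Defs

open import Data.Bool using (Bool; true; false; not; if_then_else_; _xor_; T)
open import Data.Bool.Properties
  using (not-involutive; not-injective; not-¬; xor-identityʳ; xor-comm) renaming (_≟_ to _≟ᵇ_)
open import Data.Empty using (⊥-elim)
open import Data.List using (List; []; _∷_; [_]; _++_; length; reverse; applyUpTo; concat; take; drop)
open import Data.List.Membership.Propositional using (_∈_)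
open import Data.List.Membership.Propositional.Properties using (∈-concat⁺′; ∈-applyUpTo⁺)
open import Data.List.Properties
  using (≡-dec; ∷-injective; ++-assoc; length-reverse; reverse-++; unfold-reverse;
         map-applyUpTo; length-take; take++drop≡id)
open import Data.Maybe using (Maybe; just; nothing; _<∣>_; is-just; from-just; to-witness-T)
import Data.Maybe as Maybe
open import Data.Nat
open import Data.Nat.DivMod
open import Data.Nat.Induction using (<-wellFounded)
open import Data.Nat.Properties
open import Data.Nat.Tactic.RingSolver using (solve-∀)
open import Data.Product using (∃-syntax; _×_; _,_; uncurry; proj₁; proj₂)
import Data.Product as Product
open import Data.Sum using (_⊎_; inj₁; inj₂)
open import Function using (id; _∘_; const)
open import Induction.WellFounded using (Acc; acc)
open import Relation.Binary.PropositionalEquality hiding ([_])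
open import Relation.Nullary using (¬_; Dec; yes; no; contradiction)
open import Relation.Nullary.Decidable using (_×-dec_; ¬?; T?; map′; toWitness)

-- The word is the image of a paperfolding sequence p (p(2m) = odd m,
-- p(2m+1) = p(m)) under the morphism b ↦ 0 b (not b).  The Toeplitz structure
-- of p gives, for every factor, a period 2^(K+1) at which it recurs and a
-- mirror image around 2^(K+1), since p(2^(K+1) − 2 − n) = not (p n) for small n;
-- so the word is uniformly recurrent and closed under reversal, and it inherits
-- aperiodicity from p.  Every window of length 8 of p already occurs before
-- position 48, so every factor of length at most 21 of the word occurs before
-- position 144, and finite checks there show that there is no palindrome of
-- length 20 or 21 (hence none longer), that all shorter palindromic factors
-- are privileged, and that the factor 101000100101 is privileged but not a
-- palindrome.

data Halving : ℕ → Set where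
  twice   : ∀ m → Halving (m + m)
  twice+1 : ∀ m → Halving (suc (m + m))

halving : ∀ n → Halving n
halving zero = twice 0
halving (suc n) with halving n
... | twice m   = twice+1 m
... | twice+1 m = subst Halving (cong suc (+-suc m m)) (twice (suc m))

factor : Word → ℕ → ℕ → List Bool
factor w i zero    = []
factor w i (suc n) = w i ∷ factor w (suc i) n

applyUpTo-factor : ∀ w i (f : ℕ → Bool) n → (∀ k → f k ≡ w (i + k)) → applyUpTo f n ≡ factor w i n
applyUpTo-factor w i f zero    _  = refl
applyUpTo-factor w i f (suc n) eq = cong₂ _∷_ (trans (eq 0) (cong w (+-identityʳ i)))
  (applyUpTo-factor w (suc i) (f ∘ suc) n (λ k → trans (eq (suc k)) (cong w (+-suc i k))))

factorAt≡factor : ∀ w i n → factorAt w i n ≡ factor w i n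
factorAt≡factor w i n =
  trans (map-applyUpTo id (λ k → w (i + k)) n) (applyUpTo-factor w i (λ k → w (i + k)) n (λ _ → refl))

length-factor : ∀ w i n → length (factor w i n) ≡ n
length-factor w i zero    = refl
length-factor w i (suc n) = cong suc (length-factor w (suc i) n)

factor-++ : ∀ w i m n → factor w i (m + n) ≡ factor w i m ++ factor w (i + m) n
factor-++ w i zero    n = cong (λ j → factor w j n) (sym (+-identityʳ i))
factor-++ w i (suc m) n = cong (w i ∷_)
  (trans (factor-++ w (suc i) m n) (cong (λ j → factor w (suc i) m ++ factor w j n) (sym (+-suc i m))))

factor-cong : ∀ w v i j n → (∀ {k} → k < n → w (i + k) ≡ v (j + k)) → factor w i n ≡ factor v j n
factor-cong w v i j zero    _  = refl
factor-cong w v i j (suc n) eq = cong₂ _∷_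
  (trans (cong w (sym (+-identityʳ i))) (trans (eq z<s) (cong v (+-identityʳ j))))
  (factor-cong w v (suc i) (suc j) n λ k<n →
    trans (cong w (sym (+-suc i _))) (trans (eq (s<s k<n)) (cong v (+-suc j _))))

reverse-factor : ∀ w i j n → (∀ {k} → k < n → w (j + (n ∸ suc k)) ≡ w (i + k)) →
  reverse (factor w i n) ≡ factor w j n
reverse-factor w i j zero    _      = refl
reverse-factor w i j (suc n) mirror = begin
  reverse (w i ∷ factor w (suc i) n)          ≡⟨ unfold-reverse (w i) (factor w (suc i) n) ⟩
  reverse (factor w (suc i) n) ++ [ w i ]     ≡⟨ cong₂ (λ xs x → xs ++ [ x ]) rest first ⟩
  factor w j n ++ factor w (j + n) 1          ≡⟨ sym (factor-++ w j n 1) ⟩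
  factor w j (n + 1)                          ≡⟨ cong (factor w j) (+-comm n 1) ⟩
  factor w j (suc n)                          ∎
  where
  open ≡-Reasoning
  rest : reverse (factor w (suc i) n) ≡ factor w j n
  rest = reverse-factor w (suc i) j n λ {k} k<n → trans (mirror (s<s k<n)) (cong w (+-suc i k))
  first : w i ≡ w (j + n)
  first = sym (trans (mirror z<s) (cong w (+-identityʳ i)))

closedUnderReversal-fromMirrors : ∀ w →
  (∀ i n → ∃[ j ] (∀ {k} → k < n → w (j + (n ∸ suc k)) ≡ w (i + k))) → ClosedUnderReversal w
closedUnderReversal-fromMirrors w mirrors u (i , occurs) with mirrors i (length u)
... | j , mirror = j , (begin
  factorAt w j (length (reverse u))  ≡⟨ cong (factorAt w j) (length-reverse u) ⟩
  factorAt w j (length u)            ≡⟨ factorAt≡factor w j (length u) ⟩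
  factor w j (length u)              ≡⟨ sym (reverse-factor w i j (length u) mirror) ⟩
  reverse (factor w i (length u))    ≡⟨ cong reverse (trans (sym (factorAt≡factor w i (length u))) occurs) ⟩
  reverse u                          ∎)
  where open ≡-Reasoning

round-up : ∀ x P .{{_ : NonZero P}} → x + (P ∸ x % P) ≡ suc (x / P) * P
round-up x P = begin
  x + (P ∸ x % P)                  ≡⟨ cong (_+ (P ∸ x % P)) (m≡m%n+[m/n]*n x P) ⟩
  x % P + x / P * P + (P ∸ x % P)  ≡⟨ swap (x % P) _ _ ⟩
  x % P + (P ∸ x % P) + x / P * P  ≡⟨ cong (_+ x / P * P) (m+[n∸m]≡n (m%n≤n x P)) ⟩
  P + x / P * P                    ∎
  where
  open ≡-Reasoning
  swap : ∀ a b c → a + b + c ≡ a + c + b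
  swap = solve-∀

uniformlyRecurrent-fromPeriods : ∀ w →
  (∀ i n → ∃[ P ] (0 < P × ∀ t {k} → k < n → w (i + k + t * P) ≡ w (i + k))) → UniformlyRecurrent w
uniformlyRecurrent-fromPeriods w periods u (i , occurs) with periods i (length u)
... | P , P>0 , periodic = i + P + length u , λ i' →
  let instance _ = >-nonZero P>0
      d = P ∸ i' % P
      shift : ∀ k → i' + (i + d) + k ≡ i + k + suc (i' / P) * P
      shift k = trans (regroup i' i d k) (cong (i + k +_) (round-up i' P))
      recurs : ∀ {k} → k < length u → w (i' + (i + d) + k) ≡ w (i + k)
      recurs {k} k<n = trans (cong w (shift k)) (periodic (suc (i' / P)) k<n)
  in i + d , +-monoˡ-≤ (length u) (+-monoʳ-≤ i (m∸n≤m P (i' % P))) , (begin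
    factorAt w (i' + (i + d)) (length u)  ≡⟨ factorAt≡factor w _ (length u) ⟩
    factor w (i' + (i + d)) (length u)    ≡⟨ factor-cong w w _ i (length u) recurs ⟩
    factor w i (length u)                 ≡⟨ sym (factorAt≡factor w i (length u)) ⟩
    factorAt w i (length u)               ≡⟨ occurs ⟩
    u                                     ∎)
  where
  open ≡-Reasoning
  regroup : ∀ i' i d k → i' + (i + d) + k ≡ i + k + (i' + d)
  regroup = solve-∀

++-injective : ∀ {A : Set} (a c : List A) {b d} → length a ≡ length c → a ++ b ≡ c ++ d → a ≡ c × b ≡ d
++-injective []      []      _   eq = refl , eq
++-injective (x ∷ a) (y ∷ c) len eq with ∷-injective eq
... | refl , eq' = Product.map₁ (cong (x ∷_)) (++-injective a c (suc-injective len) eq')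

palindrome-middle : ∀ x y z → length x ≡ length z → Palindrome (x ++ y ++ z) → Palindrome y
palindrome-middle x y z |x|≡|z| pal =
  proj₁ (++-injective (reverse y) y (length-reverse y) (proj₂ (++-injective (reverse z) x |z|≡|x| reversed)))
  where
  |z|≡|x| : length (reverse z) ≡ length x
  |z|≡|x| = trans (length-reverse z) (sym |x|≡|z|)
  reversed : reverse z ++ reverse y ++ reverse x ≡ x ++ y ++ z
  reversed = begin
    reverse z ++ reverse y ++ reverse x  ≡⟨ sym (++-assoc (reverse z) (reverse y) (reverse x)) ⟩
    (reverse z ++ reverse y) ++ reverse x ≡⟨ cong (_++ reverse x) (sym (reverse-++ y z)) ⟩
    reverse (y ++ z) ++ reverse x        ≡⟨ sym (reverse-++ x (y ++ z)) ⟩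
    reverse (x ++ y ++ z)                ≡⟨ pal ⟩
    x ++ y ++ z                          ∎
    where open ≡-Reasoning

palindrome-factor-middle : ∀ w i m c → Palindrome (factor w i (m + (c + m))) → Palindrome (factor w (i + m) c)
palindrome-factor-middle w i m c pal = palindrome-middle (factor w i m) (factor w (i + m) c) (factor w (i + m + c) m)
  (trans (length-factor w i m) (sym (length-factor w (i + m + c) m)))
  (subst Palindrome split pal)
  where
  split : factor w i (m + (c + m)) ≡ factor w i m ++ factor w (i + m) c ++ factor w (i + m + c) m
  split = trans (factor-++ w i m (c + m)) (cong (factor w i m ++_) (factor-++ w (i + m) c m))

-- A long palindrome has a palindrome of length c or c + 1 in its middle.
palindromicFactor-short : ∀ w c →
  (∀ i → ¬ Palindrome (factor w i c)) → (∀ i → ¬ Palindrome (factor w i (suc c))) →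
  ∀ i n → Palindrome (factor w i n) → n < c
palindromicFactor-short w c no-c no-suc-c i n pal with c ≤? n
... | no c≰n = ≰⇒> c≰n
... | yes c≤n with n ∸ c | m∸n+n≡m c≤n | halving (n ∸ c)
...   | _ | refl | twice m    =
  contradiction (palindrome-factor-middle w i m c (subst (Palindrome ∘ factor w i) (regroup m c) pal)) (no-c (i + m))
  where
  regroup : ∀ m c → m + m + c ≡ m + (c + m)
  regroup = solve-∀
...   | _ | refl | twice+1 m  =
  contradiction (palindrome-factor-middle w i m (suc c) (subst (Palindrome ∘ factor w i) (regroup m c) pal))
                (no-suc-c (i + m))
  where
  regroup : ∀ m c → suc (m + m) + c ≡ m + (suc c + m)
  regroup = solve-∀

factorsBelow : Word → ℕ → ℕ → List (List Bool)
factorsBelow w N c = concat (applyUpTo (λ i → applyUpTo (factor w i) c) N)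

finitelyManyPalindromicFactors-fromBounds : ∀ w N c →
  (∀ i n → Palindrome (factor w i n) → n < c) →
  (∀ i n → n < c → ∃[ i' ] (i' < N × factor w i' n ≡ factor w i n)) →
  FinitelyManyPalindromicFactors w
finitelyManyPalindromicFactors-fromBounds w N c short early = factorsBelow w N c , λ u (i , occurs) pal →
  let u≡factor = trans (sym (factorAt≡factor w i (length u))) occurs
      n<c = short i (length u) (subst Palindrome (sym u≡factor) pal)
      (i' , i'<N , same) = early i (length u) n<c
  in subst (_∈ factorsBelow w N c) (trans same u≡factor)
       (∈-concat⁺′ (∈-applyUpTo⁺ (factor w i') n<c)
                   (∈-applyUpTo⁺ (λ i → applyUpTo (factor w i) c) i'<N))

_≟ₗ_ : (u v : List Bool) → Dec (u ≡ v)
_≟ₗ_ = ≡-dec _≟ᵇ_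

palindrome? : ∀ u → Dec (Palindrome u)
palindrome? u = reverse u ≟ₗ u

completeFirstReturn? : ∀ k u → Maybe (CompleteFirstReturn (take k u) u)
completeFirstReturn? k u with drop (length u ∸ k) u ≟ₗ take k u | occurrences (take k u) u ≟ 2
... | yes suffix | yes two = just ((drop k u , sym (take++drop≡id k u)) , (prefix , ends) , two)
  where
  prefix = take (length u ∸ k) u
  ends : u ≡ prefix ++ take k u
  ends = trans (sym (take++drop≡id (length u ∸ k) u)) (cong (prefix ++_) suffix)
... | _ | _ = nothing

-- A sound search: borders of u are tried from the longest down, and the fuel
-- bounds the recursion depth.
privileged? : ℕ → ∀ u → Maybe (Privileged u)
privileged? _          []       = just priv-empty
privileged? _          (a ∷ []) = just (priv-letter a)
privileged? zero       _        = nothing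
privileged? (suc fuel) u        = viaBorderBelow (length u)
  where
  viaBorder : ℕ → Maybe (Privileged u)
  viaBorder k with k <? length u | completeFirstReturn? k u | privileged? fuel (take k u)
  ... | yes k<|u| | just return | just v =
    just (priv-return v (≤-<-trans (≤-trans (≤-reflexive (length-take k u)) (m⊓n≤m k _)) k<|u|) return)
  ... | _ | _ | _ = nothing
  viaBorderBelow : ℕ → Maybe (Privileged u)
  viaBorderBelow zero    = nothing
  viaBorderBelow (suc k) = viaBorder k <∣> viaBorderBelow k

privilegedIfPalindrome? : ∀ u → Maybe (Palindrome u → Privileged u)
privilegedIfPalindrome? u with palindrome? u
... | no ¬pal = just (λ pal → contradiction pal ¬pal)
... | yes _   = Maybe.map const (privileged? (length u) u)

odd : ℕ → Bool
odd zero    = false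
odd (suc n) = not (odd n)

odd-+ : ∀ m n → odd (m + n) ≡ odd m xor odd n
odd-+ zero    n = refl
odd-+ (suc m) n rewrite odd-+ m n with odd m
... | true  = not-involutive (odd n)
... | false = refl

odd-double : ∀ m → odd (m + m) ≡ false
odd-double zero    = refl
odd-double (suc m) rewrite +-suc m m | odd-double m = refl

odd-double+1 : ∀ m → odd (suc (m + m)) ≡ true
odd-double+1 m = cong not (odd-double m)

-- Recursion on ⌊ n /2⌋ with fuel; suc n is enough fuel since ⌊ n /2⌋ < n.
paperfoldingWithFuel : ℕ → ℕ → Bool
paperfoldingWithFuel zero       n = false
paperfoldingWithFuel (suc fuel) n =
  if odd n then paperfoldingWithFuel fuel ⌊ n /2⌋ else odd ⌊ n /2⌋

paperfolding : ℕ → Bool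
paperfolding n = paperfoldingWithFuel (suc n) n

paperfoldingWithFuel-enough : ∀ f g n → n < f → n < g →
  paperfoldingWithFuel f n ≡ paperfoldingWithFuel g n
paperfoldingWithFuel-enough (suc f) (suc g) zero    _         _         = refl
paperfoldingWithFuel-enough (suc f) (suc g) (suc n) (s≤s n<f) (s≤s n<g) with odd (suc n)
... | false = refl
... | true  = paperfoldingWithFuel-enough f g ⌊ suc n /2⌋
                (<-≤-trans (⌊n/2⌋<n n) n<f) (<-≤-trans (⌊n/2⌋<n n) n<g)

paperfolding-even : ∀ m → paperfolding (m + m) ≡ odd m
paperfolding-even m rewrite odd-double m = cong odd (sym (n≡⌊n+n/2⌋ m))

paperfolding-odd : ∀ m → paperfolding (suc (m + m)) ≡ paperfolding m
paperfolding-odd m rewrite odd-double m | sym (n≡⌈n+n/2⌉ m) =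
  paperfoldingWithFuel-enough (suc (m + m)) (suc m) m (s≤s (m≤m+n m m)) ≤-refl

double-injective : ∀ {m n} → m + m ≡ n + n → m ≡ n
double-injective {m} {n} eq = trans (n≡⌊n+n/2⌋ m) (trans (cong ⌊_/2⌋ eq) (sym (n≡⌊n+n/2⌋ n)))

odd≢even : ∀ m n → suc (m + m) ≢ n + n
odd≢even m n eq with trans (sym (odd-double+1 m)) (trans (cong odd eq) (odd-double n))
... | ()

2*≡+ : ∀ x → 2 * x ≡ x + x
2*≡+ x = cong (x +_) (+-identityʳ x)

odd-2* : ∀ x → odd (2 * x) ≡ false
odd-2* x = trans (cong odd (2*≡+ x)) (odd-double x)

xor≡true⇒≡not : ∀ x y → x xor y ≡ true → y ≡ not x
xor≡true⇒≡not true  false _ = refl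
xor≡true⇒≡not false true  _ = refl

2+n≰2^0 : ∀ n → 2 + n ≰ 2 ^ 0
2+n≰2^0 n (s≤s ())

halve-bound : ∀ m P → 2 + suc (m + m) ≤ 2 * P → 2 + m ≤ P
halve-bound m P h = *-cancelˡ-< 2 (suc m) P (≤-trans (≤-reflexive (expand m)) h)
  where
  expand : ∀ m → suc (2 * suc m) ≡ 2 + suc (m + m)
  expand = solve-∀

paperfolding-periodic : ∀ K n t → 2 + n ≤ 2 ^ K →
  paperfolding (n + 2 ^ suc K * t) ≡ paperfolding n
paperfolding-periodic zero n t h = ⊥-elim (2+n≰2^0 n h)
paperfolding-periodic (suc K) n t h with halving n
... | twice m = begin
  paperfolding (m + m + 2 ^ suc (suc K) * t)  ≡⟨ cong paperfolding (regroup m (2 ^ suc K) t) ⟩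
  paperfolding (x + x)                        ≡⟨ paperfolding-even x ⟩
  odd (m + 2 ^ suc K * t)                     ≡⟨ odd-+ m _ ⟩
  odd m xor odd (2 ^ suc K * t)               ≡⟨ cong (λ y → odd m xor odd y) (*-assoc 2 (2 ^ K) t) ⟩
  odd m xor odd (2 * (2 ^ K * t))             ≡⟨ cong (odd m xor_) (odd-2* (2 ^ K * t)) ⟩
  odd m xor false                             ≡⟨ xor-identityʳ (odd m) ⟩
  odd m                                       ≡⟨ sym (paperfolding-even m) ⟩
  paperfolding (m + m)                        ∎
  where
  open ≡-Reasoning
  x = m + 2 ^ suc K * t
  regroup : ∀ m P t → m + m + 2 * P * t ≡ (m + P * t) + (m + P * t)
  regroup = solve-∀
... | twice+1 m = begin
  paperfolding (suc (m + m) + 2 ^ suc (suc K) * t) ≡⟨ cong paperfolding (regroup m (2 ^ suc K) t) ⟩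
  paperfolding (suc (x + x))                       ≡⟨ paperfolding-odd x ⟩
  paperfolding (m + 2 ^ suc K * t)                 ≡⟨ paperfolding-periodic K m t (halve-bound m (2 ^ K) h) ⟩
  paperfolding m                                   ≡⟨ sym (paperfolding-odd m) ⟩
  paperfolding (suc (m + m))                       ∎
  where
  open ≡-Reasoning
  x = m + 2 ^ suc K * t
  regroup : ∀ m P t → suc (m + m) + 2 * P * t ≡ suc ((m + P * t) + (m + P * t))
  regroup = solve-∀

paperfolding-mirror : ∀ K n a → 2 + n ≤ 2 ^ K → 2 + n + a ≡ 2 ^ suc K →
  paperfolding a ≡ not (paperfolding n)
paperfolding-mirror zero n a h _ = ⊥-elim (2+n≰2^0 n h)
paperfolding-mirror (suc K) n a h e with halving n | halving a
... | twice m | twice m' = begin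
  paperfolding (m' + m') ≡⟨ paperfolding-even m' ⟩
  odd m'                 ≡⟨ xor≡true⇒≡not (odd m) (odd m') odd-sum ⟩
  not (odd m)            ≡⟨ cong not (sym (paperfolding-even m)) ⟩
  not (paperfolding (m + m)) ∎
  where
  open ≡-Reasoning
  regroup : ∀ m m' → suc (m + m') + suc (m + m') ≡ 2 + (m + m) + (m' + m')
  regroup = solve-∀
  half-sum : suc (m + m') ≡ 2 ^ suc K
  half-sum = double-injective (trans (regroup m m') (trans e (2*≡+ (2 ^ suc K))))
  odd-sum : odd m xor odd m' ≡ true
  odd-sum = trans (sym (odd-+ m m'))
              (not-injective (trans (cong odd half-sum) (odd-2* (2 ^ K))))
... | twice m | twice+1 m' = ⊥-elim (odd≢even (1 + m + m') (2 ^ suc K)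
        (trans (regroup m m') (trans e (2*≡+ (2 ^ suc K)))))
  where
  regroup : ∀ m m' → suc ((1 + m + m') + (1 + m + m')) ≡ 2 + (m + m) + suc (m' + m')
  regroup = solve-∀
... | twice+1 m | twice m' = ⊥-elim (odd≢even (1 + m + m') (2 ^ suc K)
        (trans (regroup m m') (trans e (2*≡+ (2 ^ suc K)))))
  where
  regroup : ∀ m m' → suc ((1 + m + m') + (1 + m + m')) ≡ 2 + suc (m + m) + (m' + m')
  regroup = solve-∀
... | twice+1 m | twice+1 m' = begin
  paperfolding (suc (m' + m')) ≡⟨ paperfolding-odd m' ⟩
  paperfolding m'              ≡⟨ paperfolding-mirror K m m' (halve-bound m (2 ^ K) h) half-sum ⟩
  not (paperfolding m)         ≡⟨ cong not (sym (paperfolding-odd m)) ⟩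
  not (paperfolding (suc (m + m))) ∎
  where
  open ≡-Reasoning
  regroup : ∀ m m' → (2 + m + m') + (2 + m + m') ≡ 2 + suc (m + m) + suc (m' + m')
  regroup = solve-∀
  half-sum : 2 + m + m' ≡ 2 ^ suc K
  half-sum = double-injective (trans (regroup m m') (trans e (2*≡+ (2 ^ suc K))))

paperfolding-aperiodic : ∀ q → 0 < q → ∀ N →
  ¬ (∀ k → N ≤ k → paperfolding (k + q) ≡ paperfolding k)
paperfolding-aperiodic q q>0 N = go q (<-wellFounded q) q>0
  where
  go : ∀ q → Acc _<_ q → 0 < q → ¬ (∀ k → N ≤ k → paperfolding (k + q) ≡ paperfolding k)
  go q (acc rs) q>0 periodic with halving q
  -- An odd period exchanges even and odd positions, and p is determined by
  -- parity on the even ones: p(N + q') is forced to be both odd N and its negation.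
  ... | twice+1 q' = not-¬ refl (begin
    odd N                                  ≡⟨ sym (shifted N ≤-refl) ⟩
    paperfolding (N + q')                  ≡⟨ unshifted (N + q') (m≤m+n N q') ⟩
    odd (N + q' + q' + 1)                  ≡⟨ cong odd (regroup N q') ⟩
    odd (N + suc (q' + q'))                ≡⟨ odd-+ N (suc (q' + q')) ⟩
    odd N xor odd (suc (q' + q'))          ≡⟨ cong (odd N xor_) (odd-double+1 q') ⟩
    odd N xor true                         ≡⟨ xor-comm (odd N) true ⟩
    not (odd N)                            ∎)
    where
    open ≡-Reasoning
    regroup : ∀ N q → N + q + q + 1 ≡ N + suc (q + q)
    regroup = solve-∀
    shifted : ∀ m → N ≤ m → paperfolding (m + q') ≡ odd m
    shifted m N≤m = begin
      paperfolding (m + q')                     ≡⟨ sym (paperfolding-odd (m + q')) ⟩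
      paperfolding (suc ((m + q') + (m + q')))  ≡⟨ cong paperfolding (shift m q') ⟩
      paperfolding (m + m + suc (q' + q'))      ≡⟨ periodic (m + m) (≤-trans N≤m (m≤m+n m m)) ⟩
      paperfolding (m + m)                      ≡⟨ paperfolding-even m ⟩
      odd m                                     ∎
      where
      shift : ∀ m q → suc ((m + q) + (m + q)) ≡ m + m + suc (q + q)
      shift = solve-∀
    unshifted : ∀ m → N ≤ m → paperfolding m ≡ odd (m + q' + 1)
    unshifted m N≤m = begin
      paperfolding m                                      ≡⟨ sym (paperfolding-odd m) ⟩
      paperfolding (suc (m + m))                          ≡⟨ sym (periodic (suc (m + m)) N≤2m+1) ⟩
      paperfolding (suc (m + m) + suc (q' + q'))          ≡⟨ cong paperfolding (shift m q') ⟩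
      paperfolding ((m + q' + 1) + (m + q' + 1))          ≡⟨ paperfolding-even (m + q' + 1) ⟩
      odd (m + q' + 1)                                    ∎
      where
      N≤2m+1 = ≤-trans N≤m (≤-trans (m≤m+n m m) (n≤1+n _))
      shift : ∀ m q → suc (m + m) + suc (q + q) ≡ (m + q + 1) + (m + q + 1)
      shift = solve-∀
  ... | twice (suc q') = go (suc q') (rs (m<m+n (suc q') z<s)) z<s halved
    where
    halved : ∀ k → N ≤ k → paperfolding (k + suc q') ≡ paperfolding k
    halved k N≤k = begin
      paperfolding (k + suc q')                          ≡⟨ sym (paperfolding-odd (k + suc q')) ⟩
      paperfolding (suc ((k + suc q') + (k + suc q')))   ≡⟨ cong paperfolding (shift k (suc q')) ⟩
      paperfolding (suc (k + k) + (suc q' + suc q'))     ≡⟨ periodic (suc (k + k)) N≤2k+1 ⟩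
      paperfolding (suc (k + k))                         ≡⟨ paperfolding-odd k ⟩
      paperfolding k                                     ∎
      where
      open ≡-Reasoning
      N≤2k+1 = ≤-trans N≤k (≤-trans (m≤m+n k k) (n≤1+n _))
      shift : ∀ k q → suc ((k + q) + (k + q)) ≡ suc (k + k) + (q + q)
      shift = solve-∀

record SameWindow (a b : ℕ) : Set where
  constructor sameWindow
  field
    same-parity : odd b ≡ odd a
    same-window : ∀ {k} → k < 8 → paperfolding (b + k) ≡ paperfolding (a + k)

sameWindow? : ∀ a b → Dec (SameWindow a b)
sameWindow? a b = map′ (uncurry sameWindow) (λ w → same-parity w , same-window w)
  ((odd b ≟ᵇ odd a) ×-dec allUpTo? (λ k → paperfolding (b + k) ≟ᵇ paperfolding (a + k)) 8)
  where open SameWindow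

sameWindow-refl : ∀ {a} → SameWindow a a
sameWindow-refl = sameWindow refl (λ _ → refl)

sameWindow-trans : ∀ {a b c} → SameWindow a b → SameWindow b c → SameWindow a c
sameWindow-trans (sameWindow ab wab) (sameWindow bc wbc) =
  sameWindow (trans bc ab) (λ k<8 → trans (wbc k<8) (wab k<8))

-- The window of length 8 at b + b + e is determined by odd b and the window at b.
sameWindow-double : ∀ {b b'} e → e ≤ 1 → SameWindow b b' → SameWindow (b + b + e) (b' + b' + e)
sameWindow-double {b} {b'} e e≤1 (sameWindow same-parity same-window) = sameWindow doubled-parity λ {k} k<8 → begin
  paperfolding (b' + b' + e + k)  ≡⟨ cong paperfolding (+-assoc (b' + b') e k) ⟩
  paperfolding (b' + b' + (e + k)) ≡⟨ doubled (e + k) (e+k<9 k<8) ⟩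
  paperfolding (b + b + (e + k))  ≡⟨ cong paperfolding (sym (+-assoc (b + b) e k)) ⟩
  paperfolding (b + b + e + k)    ∎
  where
  open ≡-Reasoning
  e+k<9 : ∀ {k} → k < 8 → e + k < 9
  e+k<9 {k} k<8 = ≤-trans (≤-reflexive (sym (+-suc e k))) (+-mono-≤ e≤1 k<8)
  doubled-parity : odd (b' + b' + e) ≡ odd (b + b + e)
  doubled-parity rewrite odd-+ (b' + b') e | odd-+ (b + b) e | odd-double b | odd-double b' = refl
  doubled : ∀ s → s < 9 → paperfolding (b' + b' + s) ≡ paperfolding (b + b + s)
  doubled s s<9 with halving s
  ... | twice j = begin
    paperfolding (b' + b' + (j + j)) ≡⟨ cong paperfolding (regroup b' j) ⟩
    paperfolding ((b' + j) + (b' + j)) ≡⟨ paperfolding-even (b' + j) ⟩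
    odd (b' + j)                     ≡⟨ odd-+ b' j ⟩
    odd b' xor odd j                 ≡⟨ cong (_xor odd j) same-parity ⟩
    odd b xor odd j                  ≡⟨ sym (odd-+ b j) ⟩
    odd (b + j)                      ≡⟨ sym (paperfolding-even (b + j)) ⟩
    paperfolding ((b + j) + (b + j)) ≡⟨ cong paperfolding (sym (regroup b j)) ⟩
    paperfolding (b + b + (j + j))   ∎
    where
    regroup : ∀ b j → b + b + (j + j) ≡ (b + j) + (b + j)
    regroup = solve-∀
  ... | twice+1 j = begin
    paperfolding (b' + b' + suc (j + j))   ≡⟨ cong paperfolding (regroup b' j) ⟩
    paperfolding (suc ((b' + j) + (b' + j))) ≡⟨ paperfolding-odd (b' + j) ⟩
    paperfolding (b' + j)                  ≡⟨ same-window (≤-trans (s≤s (m≤m+n j j)) (≤-pred s<9)) ⟩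
    paperfolding (b + j)                   ≡⟨ sym (paperfolding-odd (b + j)) ⟩
    paperfolding (suc ((b + j) + (b + j)))   ≡⟨ cong paperfolding (sym (regroup b j)) ⟩
    paperfolding (b + b + suc (j + j))     ∎
    where
    regroup : ∀ b j → b + b + suc (j + j) ≡ suc ((b + j) + (b + j))
    regroup = solve-∀

WindowOccursEarly : ℕ → Set
WindowOccursEarly a = ∃[ b ] (b < 48 × SameWindow a b)

-- By sameWindow-double, checking positions below 2 · 48 suffices for all positions.
windowTable : ∀ {a} → a < 96 → WindowOccursEarly a
windowTable = toWitness {a? = allUpTo? (λ a → anyUpTo? (sameWindow? a) 48) 96} _

window-occursEarly : ∀ a → WindowOccursEarly a
window-occursEarly a = go a (<-wellFounded a)
  where
  lift : ∀ {b} e → e ≤ 1 → WindowOccursEarly b → WindowOccursEarly (b + b + e)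
  lift {b} e e≤1 (b' , b'<48 , same) =
    compose (windowTable (s≤s (+-mono-≤ (+-mono-≤ (≤-pred b'<48) (≤-pred b'<48)) e≤1)))
    where
    compose : WindowOccursEarly (b' + b' + e) → WindowOccursEarly (b + b + e)
    compose (c , c<48 , same') = c , c<48 , sameWindow-trans (sameWindow-double e e≤1 same) same'
  go : ∀ a → Acc _<_ a → WindowOccursEarly a
  go a (acc rs) with a <? 48 | halving a
  ... | yes a<48 | _         = a , a<48 , sameWindow-refl
  ... | no a≮48  | twice zero = contradiction z<s a≮48
  ... | no _     | twice (suc b) =
    subst WindowOccursEarly (+-identityʳ _) (lift 0 z≤n (go (suc b) (rs (m<m+n (suc b) z<s))))
  ... | no _     | twice+1 b =
    subst WindowOccursEarly (+-comm (b + b) 1) (lift 1 ≤-refl (go b (rs (s≤s (m≤m+n b b)))))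

codeAt : ℕ → Bool → Bool
codeAt 0 b = false
codeAt 1 b = b
codeAt _ b = not b

word : ℕ → Bool
word n = codeAt (n % 3) (paperfolding (n / 3))

data Block : ℕ → Set where
  block : ∀ k r → r < 3 → Block (3 * k + r)

blocks : ∀ n → Block n
blocks n = subst Block (sym n≡3q+r) (block (n / 3) (n % 3) (m%n<n n 3))
  where
  n≡3q+r : n ≡ 3 * (n / 3) + n % 3
  n≡3q+r = trans (m≡m%n+[m/n]*n n 3) (trans (+-comm (n % 3) _) (cong (_+ n % 3) (*-comm (n / 3) 3)))

word-block : ∀ k r → r < 3 → word (3 * k + r) ≡ codeAt r (paperfolding k)
word-block k r r<3 = cong₂ (λ r' k' → codeAt r' (paperfolding k')) remainder quotient
  where
  reorder : 3 * k + r ≡ r + k * 3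
  reorder = trans (+-comm (3 * k) r) (cong (r +_) (*-comm 3 k))
  remainder : (3 * k + r) % 3 ≡ r
  remainder = trans (%-congˡ reorder) (trans ([m+kn]%n≡m%n r k 3) (m<n⇒m%n≡m r<3))
  quotient : (3 * k + r) / 3 ≡ k
  quotient = begin
    (3 * k + r) / 3    ≡⟨ /-congˡ reorder ⟩
    (r + k * 3) / 3    ≡⟨ +-distrib-/ r (k * 3) no-carry ⟩
    r / 3 + k * 3 / 3  ≡⟨ cong₂ _+_ (m<n⇒m/n≡0 r<3) (m*n/n≡m k 3) ⟩
    k                  ∎
    where
    open ≡-Reasoning
    no-carry : r % 3 + k * 3 % 3 < 3
    no-carry rewrite m*n%n≡0 k 3 ⦃ _ ⦄ | m<n⇒m%n≡m r<3 | +-identityʳ r = r<3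

block-bound : ∀ k r P → 6 + (3 * k + r) ≤ 3 * P → 2 + k ≤ P
block-bound k r P h =
  *-cancelˡ-≤ 3 (≤-trans (≤-reflexive (expand k)) (≤-trans (+-monoʳ-≤ 6 (m≤m+n (3 * k) r)) h))
  where
  expand : ∀ k → 3 * (2 + k) ≡ 6 + 3 * k
  expand = solve-∀

word-periodic : ∀ K n t → 6 + n ≤ 3 * 2 ^ K → word (n + t * (3 * 2 ^ suc K)) ≡ word n
word-periodic K n t h with blocks n
... | block k r r<3 = begin
  word (3 * k + r + t * (3 * 2 ^ suc K))       ≡⟨ cong word (regroup k r (2 ^ suc K) t) ⟩
  word (3 * (k + 2 ^ suc K * t) + r)           ≡⟨ word-block (k + 2 ^ suc K * t) r r<3 ⟩
  codeAt r (paperfolding (k + 2 ^ suc K * t))  ≡⟨ cong (codeAt r) (paperfolding-periodic K k t k-bound) ⟩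
  codeAt r (paperfolding k)                    ≡⟨ sym (word-block k r r<3) ⟩
  word (3 * k + r)                             ∎
  where
  open ≡-Reasoning
  k-bound = block-bound k r (2 ^ K) h
  regroup : ∀ k r P t → 3 * k + r + t * (3 * P) ≡ 3 * (k + P * t) + r
  regroup = solve-∀

residue-sum : ∀ k r k' r' P → 3 + (3 * k + r) + (3 * k' + r') ≡ 3 * P → (r + r') % 3 ≡ 0
residue-sum k r k' r' P e = begin
  (r + r') % 3                       ≡⟨ sym ([m+kn]%n≡m%n (r + r') (1 + k + k') 3) ⟩
  (r + r' + (1 + k + k') * 3) % 3    ≡⟨ %-congˡ (trans (regroup k r k' r') (trans e (*-comm 3 P))) ⟩
  P * 3 % 3                          ≡⟨ m*n%n≡0 P 3 ⟩
  0                                  ∎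
  where
  open ≡-Reasoning
  regroup : ∀ k r k' r' → r + r' + (1 + k + k') * 3 ≡ 3 + (3 * k + r) + (3 * k' + r')
  regroup = solve-∀

mirror-residues : ∀ r r' → r < 3 → r' < 3 → (r + r') % 3 ≡ 0 →
  (r ≡ 0 × r' ≡ 0) ⊎ (r ≡ 1 × r' ≡ 2) ⊎ (r ≡ 2 × r' ≡ 1)
mirror-residues 0 0 _ _ _ = inj₁ (refl , refl)
mirror-residues 1 2 _ _ _ = inj₂ (inj₁ (refl , refl))
mirror-residues 2 1 _ _ _ = inj₂ (inj₂ (refl , refl))
mirror-residues 0 1 _ _ ()
mirror-residues 0 2 _ _ ()
mirror-residues 1 0 _ _ ()
mirror-residues 1 1 _ _ ()
mirror-residues 2 0 _ _ ()
mirror-residues 2 2 _ _ ()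
mirror-residues (suc (suc (suc _))) _ (s≤s (s≤s (s≤s ()))) _ _
mirror-residues _ (suc (suc (suc _))) _ (s≤s (s≤s (s≤s ()))) _

word-mirror : ∀ K n m → 6 + n ≤ 3 * 2 ^ K → 3 + n + m ≡ 3 * 2 ^ suc K → word m ≡ word n
word-mirror K n m h e with blocks n | blocks m
... | block k r r<3 | block k' r' r'<3 with mirror-residues r r' r<3 r'<3 (residue-sum k r k' r' (2 ^ suc K) e)
...   | inj₁ (refl , refl) = trans (word-block k' 0 r'<3) (sym (word-block k 0 r<3))
...   | inj₂ (inj₁ (refl , refl)) = begin
  word (3 * k' + 2)              ≡⟨ word-block k' 2 r'<3 ⟩
  not (paperfolding k')          ≡⟨ cong not (paperfolding-mirror K k k' (block-bound k 1 (2 ^ K) h) halves) ⟩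
  not (not (paperfolding k))     ≡⟨ not-involutive (paperfolding k) ⟩
  paperfolding k                 ≡⟨ sym (word-block k 1 r<3) ⟩
  word (3 * k + 1)               ∎
  where
  open ≡-Reasoning
  halves : 2 + k + k' ≡ 2 ^ suc K
  halves = *-cancelˡ-≡ _ _ 3 (trans (regroup k k') e)
    where
    regroup : ∀ k k' → 3 * (2 + k + k') ≡ 3 + (3 * k + 1) + (3 * k' + 2)
    regroup = solve-∀
...   | inj₂ (inj₂ (refl , refl)) = begin
  word (3 * k' + 1)              ≡⟨ word-block k' 1 r'<3 ⟩
  paperfolding k'                ≡⟨ paperfolding-mirror K k k' (block-bound k 2 (2 ^ K) h) halves ⟩
  not (paperfolding k)           ≡⟨ sym (word-block k 2 r<3) ⟩
  word (3 * k + 2)               ∎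
  where
  open ≡-Reasoning
  halves : 2 + k + k' ≡ 2 ^ suc K
  halves = *-cancelˡ-≡ _ _ 3 (trans (regroup k k') e)
    where
    regroup : ∀ k k' → 3 * (2 + k + k') ≡ 3 + (3 * k + 2) + (3 * k' + 1)
    regroup = solve-∀

m≤3*[4*m+n] : ∀ m n → m ≤ 3 * (4 * m + n) + 0
m≤3*[4*m+n] m n = ≤-trans (m≤m+n m (11 * m + 3 * n)) (≤-reflexive (expand m n))
  where
  expand : ∀ m n → m + (11 * m + 3 * n) ≡ 3 * (4 * m + n) + 0
  expand = solve-∀

-- A period 3q is inherited by p; a period of another residue moves the 0 that
-- opens a block onto a letter that, for a suitably chosen block, is 1.
word-aperiodic : Aperiodic word
word-aperiodic (p , N , p>0 , periodic) with blocks p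
... | block zero 0 _ = contradiction p>0 λ ()
... | block (suc q) 0 _ = paperfolding-aperiodic (suc q) z<s N λ k N≤k → begin
  paperfolding (k + suc q)                 ≡⟨ sym (word-block (k + suc q) 1 (s≤s (s≤s z≤n))) ⟩
  word (3 * (k + suc q) + 1)               ≡⟨ cong word (regroup k (suc q)) ⟩
  word (3 * k + 1 + (3 * suc q + 0))       ≡⟨ periodic (3 * k + 1) (≤-trans N≤k (≤-trans (m≤m+n k _) (m≤m+n _ 1))) ⟩
  word (3 * k + 1)                         ≡⟨ word-block k 1 (s≤s (s≤s z≤n)) ⟩
  paperfolding k                           ∎
  where
  open ≡-Reasoning
  regroup : ∀ k q → 3 * (k + q) + 1 ≡ 3 * k + 1 + (3 * q + 0)
  regroup = solve-∀
... | block q 1 r<3 = not-¬ refl (begin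
  false                                    ≡⟨ sym (word-block k 0 z<s) ⟩
  word (3 * k + 0)                         ≡⟨ sym (periodic (3 * k + 0) (m≤3*[4*m+n] N (3 * q + 2))) ⟩
  word (3 * k + 0 + (3 * q + 1))           ≡⟨ cong word (regroup N q) ⟩
  word (3 * (y + y) + 1)                   ≡⟨ word-block (y + y) 1 r<3 ⟩
  paperfolding (y + y)                     ≡⟨ paperfolding-even y ⟩
  odd (suc ((N + q) + (N + q)))            ≡⟨ odd-double+1 (N + q) ⟩
  true                                     ∎)
  where
  open ≡-Reasoning
  k = 4 * N + (3 * q + 2)
  y = suc ((N + q) + (N + q))
  regroup : ∀ N q → 3 * (4 * N + (3 * q + 2)) + 0 + (3 * q + 1)
                  ≡ 3 * (suc ((N + q) + (N + q)) + suc ((N + q) + (N + q))) + 1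
  regroup = solve-∀
... | block q 2 r<3 = not-¬ refl (begin
  false                                    ≡⟨ sym (word-block k 0 z<s) ⟩
  word (3 * k + 0)                         ≡⟨ sym (periodic (3 * k + 0) (m≤3*[4*m+n] N (3 * q))) ⟩
  word (3 * k + 0 + (3 * q + 2))           ≡⟨ cong word (regroup N q) ⟩
  word (3 * (y + y) + 2)                   ≡⟨ word-block (y + y) 2 r<3 ⟩
  not (paperfolding (y + y))               ≡⟨ cong not (paperfolding-even y) ⟩
  not (odd ((N + q) + (N + q)))            ≡⟨ cong not (odd-double (N + q)) ⟩
  true                                     ∎)
  where
  open ≡-Reasoning
  k = 4 * N + 3 * q
  y = (N + q) + (N + q)
  regroup : ∀ N q → 3 * (4 * N + 3 * q) + 0 + (3 * q + 2)
                  ≡ 3 * (((N + q) + (N + q)) + ((N + q) + (N + q))) + 2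
  regroup = solve-∀
... | block q (suc (suc (suc _))) (s≤s (s≤s (s≤s ())))

n<2^n : ∀ n → n < 2 ^ n
n<2^n zero    = z<s
n<2^n (suc n) = +-mono-≤ (m^n>0 2 n) (≤-trans (n<2^n n) (m≤m+n _ 0))

≤3*2^ : ∀ {m} K → m ≤ K → m ≤ 3 * 2 ^ K
≤3*2^ K m≤K = ≤-trans m≤K (≤-trans (<⇒≤ (n<2^n K)) (m≤m+n _ _))

word-mirrors : ∀ i n → ∃[ j ] (∀ {k} → k < n → word (j + (n ∸ suc k)) ≡ word (i + k))
word-mirrors i n = j , λ {k} k<n →
  word-mirror K (i + k) (j + (n ∸ suc k)) (≤3*2^ K (+-monoʳ-≤ 6 (+-monoʳ-≤ i (<⇒≤ k<n)))) (begin
    3 + (i + k) + (j + (n ∸ suc k))  ≡⟨ regroup i k j (n ∸ suc k) ⟩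
    2 + i + (suc k + (n ∸ suc k)) + j ≡⟨ cong (λ m → 2 + i + m + j) (m+[n∸m]≡n k<n) ⟩
    2 + i + n + j                    ≡⟨ m+[n∸m]≡n (≤3*2^ (suc K) (≤-trans (+-monoˡ-≤ n (+-monoˡ-≤ i 2≤6)) (n≤1+n K))) ⟩
    3 * 2 ^ suc K                    ∎)
  where
  open ≡-Reasoning
  K = 6 + i + n
  j = 3 * 2 ^ suc K ∸ (2 + i + n)
  2≤6 = m≤n+m 2 4
  regroup : ∀ i k j d → 3 + (i + k) + (j + d) ≡ 2 + i + (suc k + d) + j
  regroup = solve-∀

word-periods : ∀ i n → ∃[ P ] (0 < P × ∀ t {k} → k < n → word (i + k + t * P) ≡ word (i + k))
word-periods i n = 3 * 2 ^ suc K , ≤-trans (m^n>0 2 (suc K)) (m≤m+n _ _) , λ t {k} k<n →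
  word-periodic K (i + k) t (≤3*2^ K (+-monoʳ-≤ 6 (+-monoʳ-≤ i (<⇒≤ k<n))))
  where
  K = 6 + i + n

sameWindow-word : ∀ {k k'} → SameWindow k k' → ∀ {m} → m < 24 → word (3 * k' + m) ≡ word (3 * k + m)
sameWindow-word {k} {k'} (sameWindow _ same-window) {m} m<24 with blocks m
... | block q r r<3 = begin
  word (3 * k' + (3 * q + r))       ≡⟨ cong word (regroup k' q r) ⟩
  word (3 * (k' + q) + r)           ≡⟨ word-block (k' + q) r r<3 ⟩
  codeAt r (paperfolding (k' + q))  ≡⟨ cong (codeAt r) (same-window q<8) ⟩
  codeAt r (paperfolding (k + q))   ≡⟨ sym (word-block (k + q) r r<3) ⟩
  word (3 * (k + q) + r)            ≡⟨ cong word (sym (regroup k q r)) ⟩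
  word (3 * k + (3 * q + r))        ∎
  where
  open ≡-Reasoning
  regroup : ∀ k q r → 3 * k + (3 * q + r) ≡ 3 * (k + q) + r
  regroup = solve-∀
  q<8 : q < 8
  q<8 = *-cancelˡ-< 3 q 8 (≤-<-trans (m≤m+n (3 * q) r) m<24)

-- A factor of length at most 21 = 3 · 8 − 3 starting in block k only reads blocks k, …, k + 7.
word-factor-occursEarly : ∀ i n → n ≤ 21 → ∃[ i' ] (i' < 144 × factor word i' n ≡ factor word i n)
word-factor-occursEarly i n n≤21 with blocks i
... | block k r r<3 with window-occursEarly k
... | k' , k'<48 , same = 3 * k' + r , bound , factor-cong word word _ _ n λ {j} j<n → begin
  word (3 * k' + r + j)    ≡⟨ cong word (+-assoc (3 * k') r j) ⟩
  word (3 * k' + (r + j))  ≡⟨ sameWindow-word same (+-mono-< r<3 (<-≤-trans j<n n≤21)) ⟩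
  word (3 * k + (r + j))   ≡⟨ cong word (sym (+-assoc (3 * k) r j)) ⟩
  word (3 * k + r + j)     ∎
  where
  open ≡-Reasoning
  bound : 3 * k' + r < 144
  bound = ≤-trans (≤-reflexive (sym (+-suc (3 * k') r))) (+-mono-≤ (*-monoʳ-≤ 3 (≤-pred k'<48)) r<3)

noPalindromesOfLength20And21 : ∀ {i} → i < 144 →
  ¬ Palindrome (factor word i 20) × ¬ Palindrome (factor word i 21)
noPalindromesOfLength20And21 = toWitness {a? = allUpTo? (λ i →
  ¬? (palindrome? (factor word i 20)) ×-dec ¬? (palindrome? (factor word i 21))) 144} _

shortPalindromesPrivileged : ∀ {i} → i < 144 → ∀ {n} → n < 20 →
  T (is-just (privilegedIfPalindrome? (factor word i n)))
shortPalindromesPrivileged = toWitness {a? = allUpTo? (λ i →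
  allUpTo? (λ n → T? (is-just (privilegedIfPalindrome? (factor word i n)))) 20) 144} _

word-factor-everywhere : ∀ (P : List Bool → Set) n → n ≤ 21 →
  (∀ {i} → i < 144 → P (factor word i n)) → ∀ i → P (factor word i n)
word-factor-everywhere P n n≤21 early i with word-factor-occursEarly i n n≤21
... | i' , i'<144 , same = subst P same (early i'<144)

word-palindromicFactor-short : ∀ i n → Palindrome (factor word i n) → n < 20
word-palindromicFactor-short = palindromicFactor-short word 20
  (word-factor-everywhere (¬_ ∘ Palindrome) 20 (n≤1+n 20) (proj₁ ∘ noPalindromesOfLength20And21))
  (word-factor-everywhere (¬_ ∘ Palindrome) 21 ≤-refl (proj₂ ∘ noPalindromesOfLength20And21))

word-palindromicFactor-privileged : ∀ u → IsFactor u word → Palindrome u → Privileged u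
word-palindromicFactor-privileged u (i , occurs) pal =
  subst Privileged u≡factor (to-witness-T (privilegedIfPalindrome? (factor word i n)) checked pal′)
  where
  n = length u
  u≡factor : factor word i n ≡ u
  u≡factor = trans (sym (factorAt≡factor word i n)) occurs
  pal′ : Palindrome (factor word i n)
  pal′ = subst Palindrome (sym u≡factor) pal
  n<20 : n < 20
  n<20 = word-palindromicFactor-short i n pal′
  checked : T (is-just (privilegedIfPalindrome? (factor word i n)))
  checked = word-factor-everywhere (T ∘ is-just ∘ privilegedIfPalindrome?) n (≤-trans (<⇒≤ n<20) (n≤1+n 20))
    (λ i<144 → shortPalindromesPrivileged i<144 n<20) i

lemma3p7 : ∃[ w ] (UniformlyRecurrent w × Aperiodic w × ClosedUnderReversal w
             × FinitelyManyPalindromicFactors w × PalFactorsProperSubsetPrivFactors w)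
lemma3p7 = word
  , uniformlyRecurrent-fromPeriods word word-periods
  , word-aperiodic
  , closedUnderReversal-fromMirrors word word-mirrors
  , finitelyManyPalindromicFactors-fromBounds word 144 20 word-palindromicFactor-short
      (λ i n n<20 → word-factor-occursEarly i n (≤-trans (<⇒≤ n<20) (n≤1+n 20)))
  , word-palindromicFactor-privileged
  , factor word 5 12 , (5 , refl) , from-just (privileged? 12 (factor word 5 12)) , λ ()
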